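{- Let $k\geq 2$ be an integer, let $\mathcal{F}$ be a finite linear $k$-uniform family with $\nu=\nu(\mathcal{F})$ and $\Delta=\Delta(\mathcal{F})$, and let $\mathcal{M}$ be a maximum matching of $\mathcal{F}$. Then $|D_1(\mathcal{F},\mathcal{M})|\leq \max\{(\Delta-1)\nu,\ k(k-1)\nu\}$.
   Context: A family is $k$-uniform if every member has exactly $k$ elements and linear if distinct members share at most one element. A matching is a set of pairwise disjoint members; $\nu(\mathcal{F})$ is the maximum matching size and a maximum matching is one of that size. $\Delta(\mathcal{F})=\max_x|\{A\in\mathcal{F}:x\in A\}|$. $X_{\mathcal{M}}=\bigcup_{A\in\mathcal{M}}A$ and $D_1(\mathcal{F},\mathcal{M})=\{A\in\mathcal{F}: |A\cap X_{\mathcal{M}}|=1\}$. -}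

module Defs where

open import Data.Nat using (ℕ; _≤_; _⊔_; _*_; _∸_; _≟_)
open import Data.Fin using (Fin)
open import Data.Fin.Subset using (Subset; ∣_∣; _∩_; _∪_; ⊥; _∈_; Empty)
open import Data.Fin.Subset.Properties using (_∈?_)
open import Data.List using (List; length; filter; foldr; map; allFin)
open import Data.List.Membership.Propositional renaming (_∈_ to _∈ₗ_)
open import Data.List.Relation.Unary.All using (All)
open import Data.List.Relation.Unary.AllPairs using (AllPairs)
open import Data.List.Relation.Unary.Unique.Propositional using (Unique)
open import Data.Product using (_×_)
open import Relation.Binary.PropositionalEquality using (_≡_; _≢_)

Family : ℕ → Set
Family n = List (Subset n)

IsFamily : ∀ {n} → Family n → Set
IsFamily F = Unique F

Uniform : ∀ {n} → ℕ → Family n → Set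
Uniform k F = All (λ A → ∣ A ∣ ≡ k) F

Linear : ∀ {n} → Family n → Set
Linear F = ∀ {A B} → A ∈ₗ F → B ∈ₗ F → A ≢ B → ∣ A ∩ B ∣ ≤ 1

Disjoint : ∀ {n} → Subset n → Subset n → Set
Disjoint A B = Empty (A ∩ B)

IsMatching : ∀ {n} → Family n → Family n → Set
IsMatching F M = Unique M × All (_∈ₗ F) M × AllPairs Disjoint M

-- a maximum matching: a matching of largest size (its size is ν(F))
IsMaximumMatching : ∀ {n} → Family n → Family n → Set
IsMaximumMatching F M =
  IsMatching F M × (∀ M′ → IsMatching F M′ → length M′ ≤ length M)

deg : ∀ {n} → Family n → Fin n → ℕ
deg F x = length (filter (λ A → x ∈? A) F)

Δ : ∀ {n} → Family n → ℕ
Δ {n} F = foldr _⊔_ 0 (map (deg F) (allFin n))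

X : ∀ {n} → Family n → Subset n
X M = foldr _∪_ ⊥ M

D₁ : ∀ {n} → Family n → Family n → Family n
D₁ F M = filter (λ A → ∣ A ∩ X M ∣ ≟ 1) F

-- Fix B ∈ M and let L be the members of D₁(F, M) meeting B; each meets X_M, hence B, in a
-- single point. Two disjoint members of L could replace B in M, so by maximality L is
-- intersecting. If all members of L pass through one point x of B, then L together with B
-- lies in the star of x, so |L| ≤ Δ − 1. Otherwise every point x of B is missed by some
-- C ∈ L, and the members of L through x meet C in pairwise distinct points of C ∖ B
-- (two of them already share x, and F is linear), so at most k − 1 of them contain x and
-- |L| ≤ k(k − 1). Summing over the ν members B of M bounds |D₁(F, M)|.
module Submission where

open import Defs
open import Data.Bool using (true; false)
open import Data.Empty using (⊥-elim)
open import Data.Fin using (Fin) renaming (_≟_ to _≟ᶠ_)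
open import Data.Fin.Subset using (Subset; ∣_∣; _∩_; _∪_; ⊥; _∈_; _∉_; Empty; Nonempty; _⊆_; _─_; _-_)
open import Data.Fin.Subset.Properties
open import Data.List using (List; []; _∷_; length; filter; foldr; map; allFin; _++_)
open import Data.List.Membership.Propositional using (find) renaming (_∈_ to _∈ₗ_; _∉_ to _∉ₗ_)
open import Data.List.Membership.Propositional.Properties
  using (∈-∃++; ∈-++⁻; ∈-++⁺ˡ; ∈-++⁺ʳ; ∈-filter⁺; ∈-filter⁻; ∈-map⁺; ∈-allFin)
open import Data.List.Properties using (filter-all; filter-none)
open import Data.List.Relation.Binary.Subset.Propositional using () renaming (_⊆_ to _⊆ₗ_)
open import Data.List.Relation.Binary.Sublist.Propositional using () renaming (⊆-refl to ⊑-refl)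
import Data.List.Relation.Binary.Sublist.Propositional.Properties as Sublist
open import Data.List.Relation.Unary.All as All using (All; []; _∷_; all?)
import Data.List.Relation.Unary.All.Properties as All
open import Data.List.Relation.Unary.AllPairs using (AllPairs; []; _∷_)
open import Data.List.Relation.Unary.Any using (here; there)
open import Data.List.Relation.Unary.Unique.Propositional using (Unique)
import Data.List.Relation.Unary.Unique.Propositional.Properties as Unique
open import Data.Nat using (ℕ; zero; suc; _≤_; _⊔_; _*_; _∸_; _+_; z≤n; s≤s; _≟_)
open import Data.Nat.Properties
open import Data.Product using (_×_; _,_; proj₁; proj₂)
open import Data.Sum using (_⊎_; inj₁; inj₂)
open import Function using (_∘_; _$_)
open import Level using (Level)
open import Relation.Binary.Core using (Rel)
open import Relation.Binary.Definitions using (Symmetric)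
open import Relation.Binary.PropositionalEquality using (_≡_; _≢_; refl; sym; trans; cong; subst)
open import Relation.Nullary using (¬_; yes; no; does)
open import Relation.Unary using (Pred; Decidable)
open import Relation.Unary.Properties using (_∪?_; _∩?_)

private
  variable
    a p q r : Level
    A : Set a
    n : ℕ

module _ {P : Pred A p} (P? : Decidable P) where

  length-filter-none : (∀ {x} → ¬ P x) → ∀ xs {m} → length (filter P? xs) ≤ m
  length-filter-none ¬P xs =
    subst (_≤ _) (sym (cong length (filter-none P? {xs} (All.tabulate λ _ → ¬P)))) z≤n

  module _ {Q : Pred A q} (Q? : Decidable Q) where

    length-filter-mono : (∀ {x} → P x → Q x) → ∀ xs → length (filter P? xs) ≤ length (filter Q? xs)
    length-filter-mono P⇒Q xs =
      Sublist.length-mono-≤ (Sublist.filter⁺ P? Q? (λ { refl → P⇒Q }) (⊑-refl {x = xs}))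

    length-filter-∪ : ∀ xs →
      length (filter (P? ∪? Q?) xs) ≤ length (filter P? xs) + length (filter Q? xs)
    length-filter-∪ [] = z≤n
    length-filter-∪ (x ∷ xs) with ih ← length-filter-∪ xs | does (P? x) | does (Q? x)
    ... | true  | true  = s≤s (≤-trans ih (+-monoʳ-≤ _ (n≤1+n _)))
    ... | true  | false = s≤s ih
    ... | false | true  = ≤-trans (s≤s ih) (≤-reflexive (sym (+-suc (length (filter P? xs)) _)))
    ... | false | false = ih

module _ {P : Pred A p} {Q : Pred A q} {R : Pred A r}
         (P? : Decidable P) (Q? : Decidable Q) (R? : Decidable R) where

  length-filter-⊆∪ : (∀ {x} → P x → Q x ⊎ R x) → ∀ xs →
    length (filter P? xs) ≤ length (filter Q? xs) + length (filter R? xs)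
  length-filter-⊆∪ P⇒Q∪R xs =
    ≤-trans (length-filter-mono P? (Q? ∪? R?) P⇒Q∪R xs) (length-filter-∪ Q? R? xs)

module _ {P : Pred A p} where

  All-remove-middle : ∀ pre {x post} → All P (pre ++ x ∷ post) → All P (pre ++ post)
  All-remove-middle pre Ps = All.++⁺ (All.++⁻ˡ pre Ps) (All.tail (All.++⁻ʳ pre Ps))

module _ {R : Rel A r} where

  AllPairs-remove-middle : ∀ pre {x post} → AllPairs R (pre ++ x ∷ post) → AllPairs R (pre ++ post)
  AllPairs-remove-middle []        (_ ∷ Rs)  = Rs
  AllPairs-remove-middle (_ ∷ pre) (Rx ∷ Rs) = All-remove-middle pre Rx ∷ AllPairs-remove-middle pre Rs

  AllPairs-middle : Symmetric R → ∀ pre {x post} → AllPairs R (pre ++ x ∷ post) → All (R x) (pre ++ post)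
  AllPairs-middle sym []        (Rx ∷ _)  = Rx
  AllPairs-middle sym (_ ∷ pre) (Ry ∷ Rs) = sym (All.head (All.++⁻ʳ pre Ry)) ∷ AllPairs-middle sym pre Rs

length-++-∷ : ∀ (pre : List A) {x} post → length (pre ++ x ∷ post) ≡ suc (length (pre ++ post))
length-++-∷ []        post = refl
length-++-∷ (_ ∷ pre) post = cong suc (length-++-∷ pre post)

Unique⇒length-mono-⊆ : ∀ {xs ys : List A} → Unique xs → xs ⊆ₗ ys → length xs ≤ length ys
Unique⇒length-mono-⊆ {xs = []} _ _ = z≤n
Unique⇒length-mono-⊆ {xs = x ∷ xs} (x∉xs ∷ uxs) xs⊆ys
  with pre , post , refl ← ∈-∃++ (xs⊆ys (here refl)) =
  subst (suc (length xs) ≤_) (sym (length-++-∷ pre post)) (s≤s (Unique⇒length-mono-⊆ uxs xs⊆pre++post))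
  where
  xs⊆pre++post : xs ⊆ₗ pre ++ post
  xs⊆pre++post {y} y∈xs with ∈-++⁻ pre (xs⊆ys (there y∈xs))
  ... | inj₁ y∈pre          = ∈-++⁺ˡ y∈pre
  ... | inj₂ (here refl)    = ⊥-elim (All.lookup x∉xs y∈xs refl)
  ... | inj₂ (there y∈post) = ∈-++⁺ʳ pre y∈post

foldr-⊔-upper : ∀ {m} ms → m ∈ₗ ms → m ≤ foldr _⊔_ 0 ms
foldr-⊔-upper (m ∷ ms) (here refl) = m≤m⊔n m _
foldr-⊔-upper (m ∷ ms) (there m∈) = m≤n⇒m≤o⊔n m (foldr-⊔-upper ms m∈)

deg≤Δ : ∀ (F : Family n) x → deg F x ≤ Δ F
deg≤Δ {n} F x = foldr-⊔-upper (map (deg F) (allFin n)) (∈-map⁺ (deg F) (∈-allFin x))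

x∈p∩q⇒x∈q∩p : ∀ {p q : Subset n} {x} → x ∈ p ∩ q → x ∈ q ∩ p
x∈p∩q⇒x∈q∩p {p = p} {q} x∈p∩q = let x∈p , x∈q = x∈p∩q⁻ p q x∈p∩q in x∈p∩q⁺ (x∈q , x∈p)

module _ {p q : Subset n} where

  Disjoint-sym : Disjoint p q → Disjoint q p
  Disjoint-sym p∩q=∅ (x , x∈q∩p) = p∩q=∅ (x , x∈p∩q⇒x∈q∩p x∈q∩p)

  Nonempty∧Disjoint⇒≢ : Nonempty p → Disjoint p q → p ≢ q
  Nonempty∧Disjoint⇒≢ (x , x∈p) p∩q=∅ refl = p∩q=∅ (x , x∈p∩q⁺ (x∈p , x∈p))

Nonempty∧Disjoint⇒Unique : ∀ {ps : Family n} → All Nonempty ps → AllPairs Disjoint ps → Unique ps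
Nonempty∧Disjoint⇒Unique []          []         = []
Nonempty∧Disjoint⇒Unique (ne ∷ nes) (d ∷ ds) =
  All.map (Nonempty∧Disjoint⇒≢ ne) d ∷ Nonempty∧Disjoint⇒Unique nes ds

x∈p⇒1≤∣p∣ : ∀ {p : Subset n} {x} → x ∈ p → 1 ≤ ∣ p ∣
x∈p⇒1≤∣p∣ x∈p = ≤-trans (s≤s z≤n) (x∈p⇒∣p-x∣<∣p∣ x∈p)

1≤∣p∣⇒Nonempty : ∀ {p : Subset n} → 1 ≤ ∣ p ∣ → Nonempty p
1≤∣p∣⇒Nonempty {n} {p} 1≤∣p∣ with nonempty? p
... | yes ne  = ne
... | no  p=∅ = ⊥-elim (1+n≰n (subst (1 ≤_) (trans (cong ∣_∣ (Empty-unique p=∅)) (∣⊥∣≡0 n)) 1≤∣p∣))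

∣p∣≤1⇒x∈p⇒y∈p⇒x≡y : ∀ {p : Subset n} → ∣ p ∣ ≤ 1 → ∀ {x y} → x ∈ p → y ∈ p → x ≡ y
∣p∣≤1⇒x∈p⇒y∈p⇒x≡y {p = p} ∣p∣≤1 {x} {y} x∈p y∈p with x ≟ᶠ y
... | yes x≡y = x≡y
... | no  x≢y = ⊥-elim (1+n≰n (≤-trans 2≤∣p∣ ∣p∣≤1))
  where
  2≤∣p∣ : 2 ≤ ∣ p ∣
  2≤∣p∣ = ≤-trans (s≤s (x∈p⇒1≤∣p∣ (x∈p∧x≢y⇒x∈p-y x∈p x≢y))) (x∈p⇒∣p-x∣<∣p∣ y∈p)

All-⊆X : ∀ (M : Family n) → All (_⊆ X M) M
All-⊆X []      = []
All-⊆X (B ∷ M) = p⊆p∪q (X M) ∷ All.map (λ C⊆XM {x} x∈C → q⊆p∪q B (X M) (C⊆XM x∈C)) (All-⊆X M)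

length≤∣∣-of-disjoint-traces : ∀ (S : Subset n) {L : Family n} → Unique L →
  (∀ {A} → A ∈ₗ L → Nonempty (A ∩ S)) →
  (∀ {A A′ y} → A ∈ₗ L → A′ ∈ₗ L → A ≢ A′ → y ∈ A → y ∈ A′ → y ∉ S) →
  length L ≤ ∣ S ∣
length≤∣∣-of-disjoint-traces S {[]}    _            _    _   = z≤n
length≤∣∣-of-disjoint-traces S {A ∷ L} (A∉L ∷ uL) meet sep
  with y , y∈A∩S ← meet (here refl) =
  ≤-trans (s≤s (length≤∣∣-of-disjoint-traces (S ─ A) uL meet′ sep′))
          (p∩q≢∅⇒∣p─q∣<∣p∣ S A (y , x∈p∩q⇒x∈q∩p y∈A∩S))
  where
  meet′ : ∀ {A′} → A′ ∈ₗ L → Nonempty (A′ ∩ (S ─ A))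
  meet′ {A′} A′∈L with z , z∈A′∩S ← meet (there A′∈L) =
    let z∈A′ , z∈S = x∈p∩q⁻ A′ S z∈A′∩S
        z∉A        = λ z∈A → sep (here refl) (there A′∈L) (All.lookup A∉L A′∈L) z∈A z∈A′ z∈S
    in z , x∈p∩q⁺ (z∈A′ , x∈p∧x∉q⇒x∈p─q z∈S z∉A)
  sep′ : ∀ {A₁ A₂ y} → A₁ ∈ₗ L → A₂ ∈ₗ L → A₁ ≢ A₂ → y ∈ A₁ → y ∈ A₂ → y ∉ S ─ A
  sep′ A₁∈L A₂∈L A₁≢A₂ y∈A₁ y∈A₂ y∈S─A = sep (there A₁∈L) (there A₂∈L) A₁≢A₂ y∈A₁ y∈A₂ (p─q⊆p S A y∈S─A)

meets? : (T : Subset n) → Decidable (λ A → Nonempty (A ∩ T))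
meets? T A = nonempty? (A ∩ T)

star : Family n → Fin n → Family n
star L x = filter (x ∈?_) L

nothing-meets-∅ : ∀ {T A : Subset n} → Empty T → ¬ Nonempty (A ∩ T)
nothing-meets-∅ {T = T} {A} T=∅ (y , y∈A∩T) = T=∅ (y , proj₂ (x∈p∩q⁻ A T y∈A∩T))

length-meeting≤ : ∀ (L : Family n) {c} m {T} → ∣ T ∣ ≤ m →
  (∀ {x} → x ∈ T → length (star L x) ≤ c) →
  length (filter (meets? T) L) ≤ m * c
length-meeting≤ L m {T} _ _ with nonempty? T
... | no T=∅ = length-filter-none (meets? T) (nothing-meets-∅ T=∅) L
length-meeting≤ L zero ∣T∣≤0 _ | yes (x , x∈T) = ⊥-elim (1+n≰n (≤-trans (x∈p⇒1≤∣p∣ x∈T) ∣T∣≤0))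
length-meeting≤ L {c} (suc m) {T} ∣T∣≤1+m star≤c | yes (x , x∈T) = begin
  length (filter (meets? T) L)
    ≤⟨ length-filter-⊆∪ (meets? T) (x ∈?_) (meets? (T - x)) at-x-or-elsewhere L ⟩
  length (star L x) + length (filter (meets? (T - x)) L)
    ≤⟨ +-mono-≤ (star≤c x∈T) (length-meeting≤ L m ∣T-x∣≤m (λ y∈T-x → star≤c (p─q⊆p T _ y∈T-x))) ⟩
  c + m * c ∎
  where
  open ≤-Reasoning
  ∣T-x∣≤m : ∣ T - x ∣ ≤ m
  ∣T-x∣≤m = ≤-pred (≤-trans (x∈p⇒∣p-x∣<∣p∣ x∈T) ∣T∣≤1+m)
  at-x-or-elsewhere : ∀ {A} → Nonempty (A ∩ T) → x ∈ A ⊎ Nonempty (A ∩ (T - x))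
  at-x-or-elsewhere {A} (y , y∈A∩T) with y∈A , y∈T ← x∈p∩q⁻ A T y∈A∩T | y ≟ᶠ x
  ... | yes refl = inj₁ y∈A
  ... | no  y≢x  = inj₂ (y , x∈p∩q⁺ (y∈A , x∈p∧x≢y⇒x∈p-y y∈T y≢x))

length-meeting-X≤ : ∀ {P : Pred (Subset n) p} (P? : Decidable P) (L : Family n) {c} (N : Family n) →
  (∀ {B} → B ∈ₗ N → length (filter (P? ∩? meets? B) L) ≤ c) →
  length (filter (P? ∩? meets? (X N)) L) ≤ length N * c
length-meeting-X≤ P? L [] _ =
  length-filter-none (P? ∩? meets? ⊥) (λ (_ , A∩⊥≠∅) → nothing-meets-∅ (∉⊥ ∘ proj₂) A∩⊥≠∅) L
length-meeting-X≤ {P = P} P? L {c} (B ∷ N) bound = begin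
  length (filter (P? ∩? meets? (B ∪ X N)) L)
    ≤⟨ length-filter-⊆∪ (P? ∩? meets? (B ∪ X N)) (P? ∩? meets? B) (P? ∩? meets? (X N)) in-B-or-X L ⟩
  length (filter (P? ∩? meets? B) L) + length (filter (P? ∩? meets? (X N)) L)
    ≤⟨ +-mono-≤ (bound (here refl)) (length-meeting-X≤ P? L N (bound ∘ there)) ⟩
  c + length N * c ∎
  where
  open ≤-Reasoning
  in-B-or-X : ∀ {A} → P A × Nonempty (A ∩ (B ∪ X N)) → P A × Nonempty (A ∩ B) ⊎ P A × Nonempty (A ∩ X N)
  in-B-or-X {A} (PA , y , y∈A∩B∪XN) with y∈A , y∈B∪XN ← x∈p∩q⁻ A (B ∪ X N) y∈A∩B∪XN
                                    with x∈p∪q⁻ B (X N) y∈B∪XN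
  ... | inj₁ y∈B  = inj₁ (PA , y , x∈p∩q⁺ (y∈A , y∈B))
  ... | inj₂ y∈XN = inj₂ (PA , y , x∈p∩q⁺ (y∈A , y∈XN))

1+m≤n⇒m≤n∸1 : ∀ {m n} → suc m ≤ n → m ≤ n ∸ 1
1+m≤n⇒m≤n∸1 (s≤s m≤n) = m≤n

record IntersectingAt (F : Family n) (B : Subset n) (L : Family n) : Set where
  field
    unique       : Unique L
    ⊆F           : ∀ {A} → A ∈ₗ L → A ∈ₗ F
    intersecting : ∀ {A A′} → A ∈ₗ L → A′ ∈ₗ L → A ≢ A′ → Nonempty (A ∩ A′)
    meets-once   : ∀ {A} → A ∈ₗ L → ∣ A ∩ B ∣ ≡ 1

module IntersectingBound {k} {F : Family n} (2≤k : 2 ≤ k) (uniform : Uniform k F) (linear : Linear F)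
         {B} (B∈F : B ∈ₗ F) {L} (L-int : IntersectingAt F B L) where

  open IntersectingAt L-int

  meets-B : ∀ {A} → A ∈ₗ L → Nonempty (A ∩ B)
  meets-B A∈L = 1≤∣p∣⇒Nonempty (≤-reflexive (sym (meets-once A∈L)))

  meets-once⇒≡ : ∀ {A x y} → A ∈ₗ L → x ∈ A → x ∈ B → y ∈ A → y ∈ B → x ≡ y
  meets-once⇒≡ A∈L x∈A x∈B y∈A y∈B =
    ∣p∣≤1⇒x∈p⇒y∈p⇒x≡y (≤-reflexive (meets-once A∈L)) (x∈p∩q⁺ (x∈A , x∈B)) (x∈p∩q⁺ (y∈A , y∈B))

  star≤k∸1 : ∀ {C x} → C ∈ₗ L → x ∈ B → x ∉ C → length (star L x) ≤ k ∸ 1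
  star≤k∸1 {C} {x} C∈L x∈B x∉C = 1+m≤n⇒m≤n∸1 $ begin-strict
    length (star L x)
      ≤⟨ length≤∣∣-of-disjoint-traces (C ─ B) (Unique.filter⁺ (x ∈?_) unique) meets-C─B separated ⟩
    ∣ C ─ B ∣
      <⟨ p∩q≢∅⇒∣p─q∣<∣p∣ C B (meets-B C∈L) ⟩
    ∣ C ∣
      ≡⟨ All.lookup uniform (⊆F C∈L) ⟩
    k ∎
    where
    open ≤-Reasoning
    meets-C─B : ∀ {A} → A ∈ₗ star L x → Nonempty (A ∩ (C ─ B))
    meets-C─B {A} A∈star with A∈L , x∈A ← ∈-filter⁻ (x ∈?_) A∈star
                        with y , y∈A∩C ← intersecting A∈L C∈L (λ { refl → x∉C x∈A }) =
      let y∈A , y∈C = x∈p∩q⁻ A C y∈A∩C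
          y∉B       = λ y∈B → x∉C (subst (_∈ C) (meets-once⇒≡ A∈L y∈A y∈B x∈A x∈B) y∈C)
      in y , x∈p∩q⁺ (y∈A , x∈p∧x∉q⇒x∈p─q y∈C y∉B)
    separated : ∀ {A A′ y} → A ∈ₗ star L x → A′ ∈ₗ star L x → A ≢ A′ → y ∈ A → y ∈ A′ → y ∉ C ─ B
    separated {A} {A′} A∈star A′∈star A≢A′ y∈A y∈A′ y∈C─B
      with A∈L , x∈A ← ∈-filter⁻ (x ∈?_) A∈star | A′∈L , x∈A′ ← ∈-filter⁻ (x ∈?_) A′∈star =
      x∉C (subst (_∈ C) y≡x (p─q⊆p C B y∈C─B))
      where
      y≡x : _ ≡ x
      y≡x = ∣p∣≤1⇒x∈p⇒y∈p⇒x≡y (linear (⊆F A∈L) (⊆F A′∈L) A≢A′)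
                              (x∈p∩q⁺ (y∈A , y∈A′)) (x∈p∩q⁺ (x∈A , x∈A′))

  B∉L : B ∉ₗ L
  B∉L B∈L = <⇒≢ 2≤k (sym k≡1)
    where
    k≡1 : k ≡ 1
    k≡1 = trans (sym (All.lookup uniform B∈F)) (trans (cong ∣_∣ (sym (∩-idem B))) (meets-once B∈L))

  common-point⇒length≤Δ∸1 : ∀ {x} → x ∈ B → All (x ∈_) L → length L ≤ Δ F ∸ 1
  common-point⇒length≤Δ∸1 {x} x∈B L∋x = 1+m≤n⇒m≤n∸1 $ begin
    length (B ∷ L) ≤⟨ Unique⇒length-mono-⊆ ((All.tabulate λ { A∈L refl → B∉L A∈L }) ∷ unique) B∷L⊆star ⟩
    deg F x        ≤⟨ deg≤Δ F x ⟩
    Δ F            ∎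
    where
    open ≤-Reasoning
    B∷L⊆star : B ∷ L ⊆ₗ star F x
    B∷L⊆star (here refl)  = ∈-filter⁺ (x ∈?_) B∈F x∈B
    B∷L⊆star (there A∈L) = ∈-filter⁺ (x ∈?_) (⊆F A∈L) (All.lookup L∋x A∈L)

  missed-point⇒length≤k*[k∸1] : ∀ {A₀ A₁ x₀} → A₀ ∈ₗ L → x₀ ∈ A₀ → x₀ ∈ B → A₁ ∈ₗ L → x₀ ∉ A₁ →
    length L ≤ k * (k ∸ 1)
  missed-point⇒length≤k*[k∸1] {A₀} {A₁} {x₀} A₀∈L x₀∈A₀ x₀∈B A₁∈L x₀∉A₁ = begin
    length L                     ≡⟨ cong length (filter-all (meets? B) (All.tabulate meets-B)) ⟨
    length (filter (meets? B) L) ≤⟨ length-meeting≤ L k (≤-reflexive (All.lookup uniform B∈F)) star≤k∸1′ ⟩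
    k * (k ∸ 1)                  ∎
    where
    open ≤-Reasoning
    star≤k∸1′ : ∀ {x} → x ∈ B → length (star L x) ≤ k ∸ 1
    star≤k∸1′ {x} x∈B with x ≟ᶠ x₀
    ... | yes refl = star≤k∸1 A₁∈L x∈B x₀∉A₁
    ... | no  x≢x₀ = star≤k∸1 A₀∈L x∈B (λ x∈A₀ → x≢x₀ (meets-once⇒≡ A₀∈L x∈A₀ x∈B x₀∈A₀ x₀∈B))

  length≤ : ∀ {A₀} → A₀ ∈ₗ L → length L ≤ (Δ F ∸ 1) ⊔ (k * (k ∸ 1))
  length≤ A₀∈L with x₀ , x₀∈A₀∩B ← meets-B A₀∈L | all? (x₀ ∈?_) L
  ... | yes L∋x₀ = m≤n⇒m≤n⊔o _ (common-point⇒length≤Δ∸1 (proj₂ (x∈p∩q⁻ _ B x₀∈A₀∩B)) L∋x₀)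
  ... | no  L∌x₀ with A₁ , A₁∈L , x₀∉A₁ ← find (All.¬All⇒Any¬ (x₀ ∈?_) L L∌x₀) =
    let x₀∈A₀ , x₀∈B = x∈p∩q⁻ _ B x₀∈A₀∩B
    in m≤n⇒m≤o⊔n _ (missed-point⇒length≤k*[k∸1] A₀∈L x₀∈A₀ x₀∈B A₁∈L x₀∉A₁)

intersecting-length≤ : ∀ {k} {F : Family n} → 2 ≤ k → Uniform k F → Linear F →
  ∀ {B} → B ∈ₗ F → ∀ {L} → IntersectingAt F B L → length L ≤ (Δ F ∸ 1) ⊔ (k * (k ∸ 1))
intersecting-length≤ _   _       _      _   {[]}    _     = z≤n
intersecting-length≤ 2≤k uniform linear B∈F {_ ∷ _} L-int =
  IntersectingBound.length≤ 2≤k uniform linear B∈F L-int (here refl)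

meets-at-most-once⇒Disjoint : ∀ {A S B C : Subset n} → ∣ A ∩ S ∣ ≤ 1 → B ⊆ S → C ⊆ S →
  Disjoint B C → Nonempty (A ∩ B) → Disjoint A C
meets-at-most-once⇒Disjoint {A = A} {B = B} {C} ∣A∩S∣≤1 B⊆S C⊆S B∩C=∅ (x , x∈A∩B) (y , y∈A∩C) =
  let x∈A , x∈B = x∈p∩q⁻ A B x∈A∩B
      y∈A , y∈C = x∈p∩q⁻ A C y∈A∩C
      x≡y       = ∣p∣≤1⇒x∈p⇒y∈p⇒x≡y ∣A∩S∣≤1 (x∈p∩q⁺ (x∈A , B⊆S x∈B)) (x∈p∩q⁺ (y∈A , C⊆S y∈C))
  in B∩C=∅ (x , x∈p∩q⁺ (x∈B , subst (_∈ C) (sym x≡y) y∈C))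

maximum⇒¬Disjoint-exchange : ∀ {F : Family n} pre {B post} → IsMaximumMatching F (pre ++ B ∷ post) →
  (∀ {A} → A ∈ₗ F → Nonempty A) →
  ∀ {A₁ A₂} → A₁ ∈ₗ F → A₂ ∈ₗ F → All (Disjoint A₁) (pre ++ post) → All (Disjoint A₂) (pre ++ post) →
  ¬ Disjoint A₁ A₂
maximum⇒¬Disjoint-exchange {F = F} pre {B} {post} ((_ , M⊆F , M-disjoint) , maximum) nonempty
  {A₁} {A₂} A₁∈F A₂∈F A₁-avoids A₂-avoids A₁∩A₂=∅ =
  1+n≰n (subst (2 + length (pre ++ post) ≤_) (length-++-∷ pre post) (maximum M′ M′-matching))
  where
  M′ : Family _
  M′ = A₁ ∷ A₂ ∷ pre ++ post
  M′⊆F : All (_∈ₗ F) M′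
  M′⊆F = A₁∈F ∷ A₂∈F ∷ All-remove-middle pre M⊆F
  M′-disjoint : AllPairs Disjoint M′
  M′-disjoint = (A₁∩A₂=∅ ∷ A₁-avoids) ∷ A₂-avoids ∷ AllPairs-remove-middle pre M-disjoint
  M′-matching : IsMatching F M′
  M′-matching = Nonempty∧Disjoint⇒Unique (All.map nonempty M′⊆F) M′-disjoint , M′⊆F , M′-disjoint

D₁? : (M : Family n) → Decidable (λ A → ∣ A ∩ X M ∣ ≡ 1)
D₁? M A = ∣ A ∩ X M ∣ ≟ 1

D₁-meeting : Family n → Family n → Subset n → Family n
D₁-meeting F M S = filter (D₁? M ∩? meets? S) F

D₁-meeting⁻ : ∀ (F M : Family n) S {A} → A ∈ₗ D₁-meeting F M S →
  A ∈ₗ F × ∣ A ∩ X M ∣ ≡ 1 × Nonempty (A ∩ S)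
D₁-meeting⁻ F M S = ∈-filter⁻ (D₁? M ∩? meets? S) {xs = F}

D₁-meeting-intersecting : ∀ {k} {F M : Family n} → 1 ≤ k → Uniform k F → IsMaximumMatching F M →
  ∀ {B} → B ∈ₗ M → ∀ {A A′} → A ∈ₗ D₁-meeting F M B → A′ ∈ₗ D₁-meeting F M B → Nonempty (A ∩ A′)
D₁-meeting-intersecting {F = F} 1≤k uniform M-max@((_ , _ , M-disjoint) , _) {B} B∈M {A} {A′} A∈ A′∈
  with nonempty? (A ∩ A′)
... | yes A∩A′≠∅ = A∩A′≠∅
... | no  A∩A′=∅ with pre , post , refl ← ∈-∃++ B∈M =
  ⊥-elim (maximum⇒¬Disjoint-exchange pre M-max nonempty
            (proj₁ (D₁-meeting⁻ F M B A∈)) (proj₁ (D₁-meeting⁻ F M B A′∈))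
            (avoids A∈) (avoids A′∈) A∩A′=∅)
  where
  M : Family _
  M = pre ++ B ∷ post
  nonempty : ∀ {A} → A ∈ₗ F → Nonempty A
  nonempty A∈F = 1≤∣p∣⇒Nonempty (≤-trans 1≤k (≤-reflexive (sym (All.lookup uniform A∈F))))
  avoids : ∀ {A} → A ∈ₗ D₁-meeting F M B → All (Disjoint A) (pre ++ post)
  avoids {A} A∈ with _ , ∣A∩X∣≡1 , A∩B≠∅ ← D₁-meeting⁻ F M B A∈ =
    All.zipWith avoid (All-remove-middle pre (All-⊆X M) , AllPairs-middle Disjoint-sym pre M-disjoint)
    where
    avoid : ∀ {C} → C ⊆ X M × Disjoint B C → Disjoint A C
    avoid (C⊆X , B∩C=∅) = meets-at-most-once⇒Disjoint {S = X M} (≤-reflexive ∣A∩X∣≡1)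
                            (All.lookup (All-⊆X M) B∈M) C⊆X B∩C=∅ A∩B≠∅

D₁-meeting-IntersectingAt : ∀ {k} {F M : Family n} → 1 ≤ k → IsFamily F → Uniform k F →
  IsMaximumMatching F M → ∀ {B} → B ∈ₗ M → IntersectingAt F B (D₁-meeting F M B)
D₁-meeting-IntersectingAt {F = F} {M} 1≤k F-unique uniform M-max {B} B∈M = record
  { unique       = Unique.filter⁺ (D₁? M ∩? meets? B) F-unique
  ; ⊆F           = proj₁ ∘ D₁-meeting⁻ F M B
  ; intersecting = λ A∈ A′∈ _ → D₁-meeting-intersecting 1≤k uniform M-max B∈M A∈ A′∈
  ; meets-once   = meets-once
  }
  where
  meets-once : ∀ {A} → A ∈ₗ D₁-meeting F M B → ∣ A ∩ B ∣ ≡ 1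
  meets-once {A} A∈ with _ , ∣A∩X∣≡1 , (x , x∈A∩B) ← D₁-meeting⁻ F M B A∈ =
    ≤-antisym (≤-trans (p⊆q⇒∣p∣≤∣q∣ A∩B⊆A∩X) (≤-reflexive ∣A∩X∣≡1)) (x∈p⇒1≤∣p∣ x∈A∩B)
    where
    A∩B⊆A∩X : A ∩ B ⊆ A ∩ X M
    A∩B⊆A∩X y∈A∩B = let y∈A , y∈B = x∈p∩q⁻ A B y∈A∩B in x∈p∩q⁺ (y∈A , All.lookup (All-⊆X M) B∈M y∈B)

D₁-meeting-length≤ : ∀ {k} {F M : Family n} → 2 ≤ k → IsFamily F → Uniform k F → Linear F →
  IsMaximumMatching F M → ∀ {B} → B ∈ₗ M → length (D₁-meeting F M B) ≤ (Δ F ∸ 1) ⊔ (k * (k ∸ 1))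
D₁-meeting-length≤ 2≤k F-unique uniform linear M-max@((_ , M⊆F , _) , _) B∈M =
  intersecting-length≤ 2≤k uniform linear (All.lookup M⊆F B∈M)
    (D₁-meeting-IntersectingAt (<⇒≤ 2≤k) F-unique uniform M-max B∈M)

length-D₁≤length-D₁-meeting-X : ∀ (F M : Family n) → length (D₁ F M) ≤ length (D₁-meeting F M (X M))
length-D₁≤length-D₁-meeting-X F M = length-filter-mono (D₁? M) (D₁? M ∩? meets? (X M)) meets-X F
  where
  meets-X : ∀ {A} → ∣ A ∩ X M ∣ ≡ 1 → ∣ A ∩ X M ∣ ≡ 1 × Nonempty (A ∩ X M)
  meets-X ∣A∩X∣≡1 = ∣A∩X∣≡1 , 1≤∣p∣⇒Nonempty (≤-reflexive (sym ∣A∩X∣≡1))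

lemma3 : (k n : ℕ) → 2 ≤ k → (F M : Family n) →
    IsFamily F → Uniform k F → Linear F → IsMaximumMatching F M →
    length (D₁ F M) ≤ ((Δ F ∸ 1) * length M) ⊔ (k * (k ∸ 1) * length M)
lemma3 k n 2≤k F M F-unique uniform linear M-max = begin
  length (D₁ F M)               ≤⟨ length-D₁≤length-D₁-meeting-X F M ⟩
  length (D₁-meeting F M (X M)) ≤⟨ length-meeting-X≤ (D₁? M) F M
                                     (D₁-meeting-length≤ 2≤k F-unique uniform linear M-max) ⟩
  length M * c                  ≡⟨ *-comm (length M) c ⟩
  c * length M                  ≡⟨ *-distribʳ-⊔ (length M) (Δ F ∸ 1) (k * (k ∸ 1)) ⟩
  ((Δ F ∸ 1) * length M) ⊔ (k * (k ∸ 1) * length M) ∎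
  where
  open ≤-Reasoning
  c : ℕ
  c = (Δ F ∸ 1) ⊔ (k * (k ∸ 1))
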